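{- Let $w\ge1$, $h\ge 3$ and let $G=P_w(U)\sqcap C_h$ for a root set $U\subseteq\{1,\dots,w\}$. 1. If $U=\{1\}$ or $U=\{w\}$, then $Z(G)\le\lceil h/2\rceil$. 2. If $U=\{i\}$ with $i\neq1$ and $i\ne w$, then $Z(G)\le h$.
   Context: All graphs are finite, simple and undirected. The path $P_n$ has vertex set $\{1,\dots,n\}$ and edges $\{k,k+1\}$ for $1\le k\le n-1$; the cycle $C_n$ ($n\ge3$) has vertex set $\{1,\dots,n\}$ and edges $\{k,k+1\}$ for $1\le k\le n-1$ together with $\{n,1\}$. For graphs $W,H$ and a subset $U\subseteq V(W)$ (the root set), the (generalized) hierarchical product $W(U)\sqcap H$ is the graph with vertex set $V(W)\times V(H)$ in which $(x_1,y_1)$ and $(x_2,y_2)$ are adjacent if and only if either ($x_1=x_2\in U$ and $y_1y_2\in E(H)$) or ($y_1=y_2$ and $x_1x_2\in E(W)$). Zero forcing: starting from a set $S$ of filled vertices, repeatedly apply the color change rule: if a filled vertex has exactly one unfilled neighbor, that neighbor becomes filled. $S$ is a zero forcing set if this eventually fills every vertex. The zero forcing number $Z(G)$ is the minimum size of a zero forcing set of $G$. -}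

module Defs where

open import Level using (0ℓ)
open import Data.Nat using (ℕ; zero; suc; _+_; _∸_; _≤_)
open import Data.Fin using (Fin; toℕ)
open import Data.Product using (_×_; Σ; ∃)
open import Data.Sum using (_⊎_)
open import Data.List using (List; length)
open import Data.List.Membership.Propositional using (_∈_)
open import Relation.Binary.PropositionalEquality using (_≡_; _≢_)

record Graph : Set₁ where
  field
    V   : Set
    Adj : V → V → Set

open Graph public

-- Vertices are 0-indexed: vertex k of the paper (1 ≤ k ≤ n) is the Fin n element with toℕ = k - 1.

PathAdj : (n : ℕ) → Fin n → Fin n → Set
PathAdj n a b = (suc (toℕ a) ≡ toℕ b) ⊎ (suc (toℕ b) ≡ toℕ a)

CycleAdj : (n : ℕ) → Fin n → Fin n → Set
CycleAdj n a b =
  PathAdj n a b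
  ⊎ ((toℕ a ≡ 0 × toℕ b ≡ n ∸ 1) ⊎ (toℕ b ≡ 0 × toℕ a ≡ n ∸ 1))

HierProd : (W : Graph) → (U : V W → Set) → (H : Graph) → Graph
HierProd W U H = record
  { V   = V W × V H
  ; Adj = λ p q →
      let x₁ = Data.Product.proj₁ p ; y₁ = Data.Product.proj₂ p
          x₂ = Data.Product.proj₁ q ; y₂ = Data.Product.proj₂ q
      in  (x₁ ≡ x₂ × U x₁ × Adj H y₁ y₂) ⊎ (y₁ ≡ y₂ × Adj W x₁ x₂)
  }

Path : ℕ → Graph
Path n = record { V = Fin n ; Adj = PathAdj n }

Cycle : ℕ → Graph
Cycle n = record { V = Fin n ; Adj = CycleAdj n }

data Filled (G : Graph) (S : List (V G)) : V G → Set where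
  initial : ∀ {v} → v ∈ S → Filled G S v
  force   : ∀ {u v} → Filled G S u → Adj G u v →
            (∀ x → Adj G u x → x ≢ v → Filled G S x) → Filled G S v

ZeroForcingSet : (G : Graph) → List (V G) → Set
ZeroForcingSet G S = ∀ v → Filled G S v

-- Z(G) ≤ k : some zero forcing set has at most k elements.
-- (A list of length ≤ k; duplicates only increase length, so this is the cardinality bound.)
ZeroForcingNumber≤ : Graph → ℕ → Set
ZeroForcingNumber≤ G k = Σ (List (V G)) λ S → length S ≤ k × ZeroForcingSet G S

-- A vertex (x', y) forces its path neighbour (x, y) further from a chosen end of P_w once the
-- nearer part of row y is filled and, when x' is the root, the cycle neighbours of (x', y) are
-- filled too.  Hence a full end column fills the whole graph, so Z ≤ h for every root.  When the
-- root i is an end of the path, seed the opposite end in rows 0 and 1, 3, 5, … below h − 1, that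
-- is ⌈h/2⌉ vertices.  These rows fill up to column i, where each seeded odd row 2j − 1 forces row
-- 2j, and row 0 forces row h − 1 when h is even; the full column i then fills the rest.
module Submission where

open import Defs
open import Data.Nat using (ℕ; zero; suc; _+_; _∸_; _≤_; _<_; z≤n; s≤s; ⌊_/2⌋; ⌈_/2⌉)
open import Data.Nat.Properties
open import Data.Fin using (Fin; toℕ; fromℕ<; opposite) renaming (zero to fzero)
open import Data.Fin.Properties
  using (toℕ-injective; toℕ<n; toℕ-fromℕ<; opposite-prop; opposite-involutive)
open import Data.Product using (_×_; _,_; ∃-syntax)
open import Data.Sum using (_⊎_; inj₁; inj₂)
open import Data.List using (List; _∷_; map; allFin; length)
open import Data.List.Properties using (length-map; length-tabulate)
open import Data.List.Membership.Propositional using (_∈_)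
open import Data.List.Membership.Propositional.Properties using (∈-map⁺; ∈-allFin)
open import Data.List.Relation.Unary.Any using (here; there)
open import Data.Empty using (⊥-elim)
open import Function using (_∘_)
open import Relation.Binary.PropositionalEquality

-- rank x is the distance of x from one fixed end of the path.
record EndNumbering (w : ℕ) : Set where
  field
    rank           : Fin w → ℕ
    rank-injective : ∀ {a b} → rank a ≡ rank b → a ≡ b
    rank-adjacent  : ∀ {a b} → PathAdj w a b → suc (rank a) ≡ rank b ⊎ suc (rank b) ≡ rank a
    predecessor    : ∀ x k → rank x ≡ suc k → ∃[ x' ] rank x' ≡ k × PathAdj w x' x

  rank-induction : (P : Fin w → Set) →
    (∀ x → rank x ≡ 0 → P x) →
    (∀ x' x → PathAdj w x' x → rank x ≡ suc (rank x') → (∀ a → rank a ≤ rank x' → P a) → P x) →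
    ∀ x → P x
  rank-induction P base step x = up-to (rank x) x ≤-refl
    where
    up-to : ∀ k x → rank x ≤ k → P x
    up-to zero    x r≤0   = base x (n≤0⇒n≡0 r≤0)
    up-to (suc k) x r≤1+k with m≤n⇒m<n∨m≡n r≤1+k
    ... | inj₁ r<1+k = up-to k x (≤-pred r<1+k)
    ... | inj₂ r≡1+k with predecessor x k r≡1+k
    ...   | x' , r'≡k , x'~x =
      step x' x x'~x (trans r≡1+k (cong suc (sym r'≡k)))
        (λ a ra≤r' → up-to k a (≤-trans ra≤r' (≤-reflexive r'≡k)))

open EndNumbering

fromStart : ∀ w → EndNumbering w
fromStart w = record
  { rank = toℕ ; rank-injective = toℕ-injective ; rank-adjacent = λ adj → adj
  ; predecessor = predecessor-toℕ }
  where
  predecessor-toℕ : ∀ x k → toℕ x ≡ suc k → ∃[ x' ] toℕ x' ≡ k × PathAdj w x' x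
  predecessor-toℕ x k x≡1+k =
    fromℕ< k<w , toℕ-fromℕ< k<w , inj₁ (trans (cong suc (toℕ-fromℕ< k<w)) (sym x≡1+k))
    where
    k<w : k < w
    k<w = <-trans (n<1+n k) (subst (_< w) x≡1+k (toℕ<n x))

suc-opposite : ∀ {w} {a b : Fin w} → suc (toℕ a) ≡ toℕ b → suc (toℕ (opposite b)) ≡ toℕ (opposite a)
suc-opposite {suc w} {a} {b} 1+a≡b = begin
  suc (toℕ (opposite b)) ≡⟨ cong suc (opposite-prop b) ⟩
  suc (w ∸ toℕ b)        ≡⟨ +-∸-assoc 1 (≤-pred (toℕ<n b)) ⟨
  suc w ∸ toℕ b          ≡⟨ cong (suc w ∸_) 1+a≡b ⟨
  w ∸ toℕ a              ≡⟨ opposite-prop a ⟨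
  toℕ (opposite a)       ∎
  where open ≡-Reasoning

PathAdj-opposite : ∀ {w} {a b : Fin w} → PathAdj w a b → PathAdj w (opposite a) (opposite b)
PathAdj-opposite (inj₁ 1+a≡b) = inj₂ (suc-opposite 1+a≡b)
PathAdj-opposite (inj₂ 1+b≡a) = inj₁ (suc-opposite 1+b≡a)

opposite-injective : ∀ {w} {a b : Fin w} → opposite a ≡ opposite b → a ≡ b
opposite-injective {a = a} {b} eq =
  trans (sym (opposite-involutive a)) (trans (cong opposite eq) (opposite-involutive b))

reverse : ∀ {w} → EndNumbering w → EndNumbering w
reverse {w} N = record
  { rank = rank N ∘ opposite
  ; rank-injective = opposite-injective ∘ rank-injective N
  ; rank-adjacent = rank-adjacent N ∘ PathAdj-opposite
  ; predecessor = predecessor-opposite }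
  where
  predecessor-opposite : ∀ x k → rank N (opposite x) ≡ suc k →
    ∃[ x' ] rank N (opposite x') ≡ k × PathAdj w x' x
  predecessor-opposite x k r≡1+k with predecessor N (opposite x) k r≡1+k
  ... | x'' , r''≡k , x''~x =
    opposite x'' , trans (cong (rank N) (opposite-involutive x'')) r''≡k ,
    subst (PathAdj w (opposite x'')) (opposite-involutive x) (PathAdj-opposite x''~x)

module Product {w : ℕ} {U : Fin w → Set} {H : Graph} (S : List (Fin w × V H)) where

  G : Graph
  G = HierProd (Path w) U H

  F : Fin w × V H → Set
  F = Filled G S

  root-force : ∀ {r u t} → U r → (∀ x → F (x , u)) → Adj H u t →
    (∀ b → Adj H u b → b ≢ t → F (r , b)) → F (r , t)
  root-force {r} {u} {t} root row u~t column = force (row r) (inj₁ (refl , root , u~t)) others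
    where
    others : ∀ q → Adj G (r , u) q → q ≢ (r , t) → F q
    others (a , b) (inj₁ (refl , _ , u~b)) q≢rt = column b u~b (q≢rt ∘ cong (r ,_))
    others (a , b) (inj₂ (refl , _))       _    = row a

  module Sweep (N : EndNumbering w) where

    forward-force : ∀ {x' x y} → PathAdj w x' x → rank N x ≡ suc (rank N x') →
      (∀ a → rank N a ≤ rank N x' → F (a , y)) →
      (U x' → ∀ y' → Adj H y y' → F (x' , y')) → F (x , y)
    forward-force {x'} {x} {y} x'~x r≡1+r' row root-column =
      force (row x' ≤-refl) (inj₂ (refl , x'~x)) others
      where
      others : ∀ q → Adj G (x' , y) q → q ≢ (x , y) → F q
      others (a , b) (inj₁ (refl , root , y~b)) _ = root-column root b y~b
      others (a , b) (inj₂ (refl , x'~a)) q≢xy with rank-adjacent N x'~a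
      ... | inj₁ 1+r'≡ra =
        ⊥-elim (q≢xy (cong (_, y) (rank-injective N (trans (sym 1+r'≡ra) (sym r≡1+r')))))
      ... | inj₂ 1+ra≡r' = row a (≤-trans (n≤1+n (rank N a)) (≤-reflexive 1+ra≡r'))

    row-filled : ∀ y → (∀ x → rank N x ≡ 0 → F (x , y)) →
      (∀ r → U r → ∀ x → rank N x ≤ rank N r) → ∀ x → F (x , y)
    row-filled y start roots-last = rank-induction N (λ x → F (x , y)) start step
      where
      step : ∀ x' x → PathAdj w x' x → rank N x ≡ suc (rank N x') →
        (∀ a → rank N a ≤ rank N x' → F (a , y)) → F (x , y)
      step x' x x'~x r≡1+r' row = forward-force x'~x r≡1+r' row λ root →
        ⊥-elim (1+n≰n (subst (_≤ rank N x') r≡1+r' (roots-last x' root x)))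

    all-filled : (∀ x → rank N x ≡ 0 → ∀ y → F (x , y)) → ∀ v → F v
    all-filled start (x , y) = rank-induction N (λ x → ∀ y → F (x , y)) start step x y
      where
      step : ∀ x' x → PathAdj w x' x → rank N x ≡ suc (rank N x') →
        (∀ a → rank N a ≤ rank N x' → ∀ y → F (a , y)) → ∀ y → F (x , y)
      step x' x x'~x r≡1+r' columns y =
        forward-force x'~x r≡1+r' (λ a ra≤r' → columns a ra≤r' y) (λ _ y' _ → columns x' ≤-refl y')

first-column-zeroForcing : ∀ {w} {U : Fin (suc w) → Set} {H : Graph} (ys : List (V H)) →
  (∀ y → y ∈ ys) → ZeroForcingNumber≤ (HierProd (Path (suc w)) U H) (length ys)
first-column-zeroForcing {w} ys complete = S , ≤-reflexive (length-map _ ys) , all-filled start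
  where
  S : List (Fin (suc w) × _)
  S = map (fzero ,_) ys
  open Product S
  open Sweep (fromStart (suc w))
  start : ∀ x → toℕ x ≡ 0 → ∀ y → F (x , y)
  start fzero _ y = initial (∈-map⁺ (fzero ,_) (complete y))

parity-split : ∀ n → ∃[ j ] (n ≡ j + j ⊎ n ≡ suc (j + j))
parity-split zero = 0 , inj₁ refl
parity-split (suc n) with parity-split n
... | j , inj₁ n≡2j   = j , inj₂ (cong suc n≡2j)
... | j , inj₂ n≡1+2j = suc j , inj₁ (trans (cong suc n≡1+2j) (cong suc (sym (+-suc j j))))

<⌊/2⌋⇒odd< : ∀ k n → k < ⌊ n /2⌋ → suc (k + k) < n
<⌊/2⌋⇒odd< zero    (suc (suc n)) _             = s≤s (s≤s z≤n)
<⌊/2⌋⇒odd< (suc k) (suc (suc n)) (s≤s k<⌊n/2⌋) =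
  subst (_< suc (suc n)) (cong suc (sym (+-suc (suc k) k))) (s≤s (s≤s (<⌊/2⌋⇒odd< k n k<⌊n/2⌋)))

odd<⇒<⌊/2⌋ : ∀ k n → suc (k + k) < n → k < ⌊ n /2⌋
odd<⇒<⌊/2⌋ zero    (suc zero)    (s≤s ())
odd<⇒<⌊/2⌋ zero    (suc (suc n)) _ = s≤s z≤n
odd<⇒<⌊/2⌋ (suc k) (suc (suc n)) (s≤s (s≤s 3+2k≤n)) =
  s≤s (odd<⇒<⌊/2⌋ k n (subst (_≤ n) (cong suc (+-suc k k)) 3+2k≤n))

-- The cycle has length 2 + n; the seeds are rows 0 and 1, 3, 5, … up to n.
module AlternateSeeds (n : ℕ) where

  odd<2+n : (k : Fin ⌊ suc n /2⌋) → suc (toℕ k + toℕ k) < suc (suc n)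
  odd<2+n k = <-trans (<⌊/2⌋⇒odd< (toℕ k) (suc n) (toℕ<n k)) (n<1+n (suc n))

  oddRow : Fin ⌊ suc n /2⌋ → Fin (suc (suc n))
  oddRow k = fromℕ< (odd<2+n k)

  seeds : List (Fin (suc (suc n)))
  seeds = fzero ∷ map oddRow (allFin _)

  length-seeds : length seeds ≡ ⌈ suc (suc n) /2⌉
  length-seeds = cong suc (trans (length-map oddRow (allFin _)) (length-tabulate _))

  odd-seed : ∀ y j → toℕ y ≡ suc (j + j) → suc (j + j) ≤ n → y ∈ seeds
  odd-seed y j y≡1+2j 1+2j≤n =
    there (subst (_∈ map oddRow (allFin _)) oddRow-k≡y (∈-map⁺ oddRow (∈-allFin k)))
    where
    j<m : j < ⌊ suc n /2⌋
    j<m = odd<⇒<⌊/2⌋ j (suc n) (s≤s 1+2j≤n)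
    k : Fin ⌊ suc n /2⌋
    k = fromℕ< j<m
    oddRow-k≡y : oddRow k ≡ y
    oddRow-k≡y = toℕ-injective (trans (toℕ-fromℕ< (odd<2+n k))
      (trans (cong (λ z → suc (z + z)) (toℕ-fromℕ< j<m)) (sym y≡1+2j)))

  -- C is the filled part of the root column; `forces` is the colour change rule at a seeded
  -- row u, whose path neighbours are already filled.
  module Spread (C : Fin (suc (suc n)) → Set) (seeded : ∀ y → y ∈ seeds → C y)
    (forces : ∀ u t → u ∈ seeds → CycleAdj (suc (suc n)) u t →
              (∀ b → CycleAdj (suc (suc n)) u b → b ≢ t → C b) → C t) where

    even-filled : ∀ j y → toℕ y ≡ j + j → C y
    even-filled zero    y y≡0    = seeded y (here (toℕ-injective y≡0))
    even-filled (suc j) y y≡[1+j]+[1+j] =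
      forces u y (odd-seed u j u≡1+2j 1+2j≤n) (inj₁ (inj₁ 1+u≡y)) others
      where
      y≡2+2j : toℕ y ≡ suc (suc (j + j))
      y≡2+2j = trans y≡[1+j]+[1+j] (cong suc (+-suc j j))
      1+2j≤n : suc (j + j) ≤ n
      1+2j≤n = ≤-pred (≤-pred (subst (_< suc (suc n)) y≡2+2j (toℕ<n y)))
      1+2j<2+n : suc (j + j) < suc (suc n)
      1+2j<2+n = s≤s (m≤n⇒m≤1+n 1+2j≤n)
      u : Fin (suc (suc n))
      u = fromℕ< 1+2j<2+n
      u≡1+2j : toℕ u ≡ suc (j + j)
      u≡1+2j = toℕ-fromℕ< 1+2j<2+n
      1+u≡y : suc (toℕ u) ≡ toℕ y
      1+u≡y = trans (cong suc u≡1+2j) (sym y≡2+2j)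
      others : ∀ b → CycleAdj (suc (suc n)) u b → b ≢ y → C b
      others b (inj₁ (inj₁ 1+u≡b)) b≢y = ⊥-elim (b≢y (toℕ-injective (trans (sym 1+u≡b) 1+u≡y)))
      others b (inj₁ (inj₂ 1+b≡u)) _   = even-filled j b (suc-injective (trans 1+b≡u u≡1+2j))
      others b (inj₂ (inj₁ (u≡0 , _))) _ = ⊥-elim (1+n≢0 (trans (sym u≡1+2j) u≡0))
      others b (inj₂ (inj₂ (_ , u≡1+n))) _ =
        ⊥-elim (1+n≰n (subst (_≤ n) (trans (sym u≡1+2j) u≡1+n) 1+2j≤n))

    last-filled : 1 ≤ n → ∀ y → toℕ y ≡ suc n → C y
    last-filled 1≤n y y≡1+n = forces fzero y (here refl) (inj₂ (inj₁ (refl , y≡1+n))) others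
      where
      others : ∀ b → CycleAdj (suc (suc n)) fzero b → b ≢ y → C b
      others b (inj₁ (inj₁ 1≡b))           _   = seeded b (odd-seed b 0 (sym 1≡b) 1≤n)
      others b (inj₂ (inj₁ (_ , b≡1+n))) b≢y = ⊥-elim (b≢y (toℕ-injective (trans b≡1+n (sym y≡1+n))))

    spread : 1 ≤ n → ∀ y → C y
    spread 1≤n y with parity-split (toℕ y)
    ... | j , inj₁ y≡2j   = even-filled j y y≡2j
    ... | j , inj₂ y≡1+2j with m≤n⇒m<n∨m≡n (≤-pred (toℕ<n y))
    ...   | inj₁ y<1+n = seeded y (odd-seed y j y≡1+2j (subst (_≤ n) y≡1+2j (≤-pred y<1+n)))
    ...   | inj₂ y≡1+n = last-filled 1≤n y y≡1+n

module EndRooted {w : ℕ} (N : EndNumbering w) (i : Fin w)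
  (opposite-first : rank N (opposite i) ≡ 0) (i-last : ∀ x → rank N x ≤ rank N i)
  (n : ℕ) (1≤n : 1 ≤ n) where

  open AlternateSeeds n

  S : List (Fin w × Fin (suc (suc n)))
  S = map (opposite i ,_) seeds

  open Product {U = _≡ i} {H = Cycle (suc (suc n))} S

  seeded-row : ∀ y → y ∈ seeds → ∀ x → F (x , y)
  seeded-row y y∈seeds = Sweep.row-filled N y start roots-last
    where
    start : ∀ x → rank N x ≡ 0 → F (x , y)
    start x rx≡0 = initial (subst (λ z → (z , y) ∈ S) x-is-first (∈-map⁺ (opposite i ,_) y∈seeds))
      where
      x-is-first : opposite i ≡ x
      x-is-first = rank-injective N (trans opposite-first (sym rx≡0))
    roots-last : ∀ r → r ≡ i → ∀ x → rank N x ≤ rank N r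
    roots-last _ refl = i-last

  root-column : ∀ y → F (i , y)
  root-column = Spread.spread (λ y → F (i , y)) (λ y y∈seeds → seeded-row y y∈seeds i)
    (λ u t u∈seeds → root-force refl (seeded-row u u∈seeds)) 1≤n

  zeroForcing : ZeroForcingNumber≤ G ⌈ suc (suc n) /2⌉
  zeroForcing =
    S , ≤-reflexive (trans (length-map _ seeds) length-seeds) , Sweep.all-filled (reverse N) start
    where
    start : ∀ x → rank N (opposite x) ≡ 0 → ∀ y → F (x , y)
    start x rx≡0 y = subst (λ z → F (z , y)) i-is-x (root-column y)
      where
      i-is-x : i ≡ x
      i-is-x = rank-injective (reverse N) (trans opposite-first (sym rx≡0))

opposite-of-last : ∀ {w} (i : Fin (suc w)) → toℕ i ≡ w → toℕ (opposite i) ≡ 0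
opposite-of-last {w} i i≡w = trans (opposite-prop {suc w} i) (trans (cong (w ∸_) i≡w) (n∸n≡0 w))

opposite-maximal : ∀ {w} (i : Fin (suc w)) → toℕ i ≡ 0 → ∀ x → toℕ (opposite x) ≤ toℕ (opposite i)
opposite-maximal {w} i i≡0 x = begin
  toℕ (opposite x) ≡⟨ opposite-prop {suc w} x ⟩
  w ∸ toℕ x        ≤⟨ m∸n≤m w (toℕ x) ⟩
  w ∸ 0            ≡⟨ cong (w ∸_) i≡0 ⟨
  w ∸ toℕ i        ≡⟨ opposite-prop {suc w} i ⟨
  toℕ (opposite i) ∎
  where open ≤-Reasoning

mainTheorem8 : (w h : ℕ) → 1 ≤ w → 3 ≤ h →
  ((i : Fin w) → (toℕ i ≡ 0 ⊎ toℕ i ≡ w ∸ 1) →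
    ZeroForcingNumber≤ (HierProd (Path w) (λ x → x ≡ i) (Cycle h)) ⌈ h /2⌉)
  × ((i : Fin w) → toℕ i ≢ 0 → toℕ i ≢ w ∸ 1 →
    ZeroForcingNumber≤ (HierProd (Path w) (λ x → x ≡ i) (Cycle h)) h)
mainTheorem8 zero    _                   ()  _
mainTheorem8 (suc w) (suc zero)          _   (s≤s ())
mainTheorem8 (suc w) (suc (suc zero))    _   (s≤s (s≤s ()))
mainTheorem8 (suc w) (suc (suc (suc n))) _ _ = end-root , λ _ _ _ → all-rows
  where
  all-rows : ∀ {U} → ZeroForcingNumber≤ (HierProd (Path (suc w)) U (Cycle (3 + n))) (3 + n)
  all-rows = subst (ZeroForcingNumber≤ _) (length-tabulate {n = 3 + n} (λ k → k))
                   (first-column-zeroForcing (allFin _) ∈-allFin)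
  end-root : (i : Fin (suc w)) → toℕ i ≡ 0 ⊎ toℕ i ≡ w →
    ZeroForcingNumber≤ (HierProd (Path (suc w)) (_≡ i) (Cycle (3 + n))) ⌈ 3 + n /2⌉
  end-root i (inj₁ i≡0) = EndRooted.zeroForcing (reverse (fromStart _)) i
    (trans (cong toℕ (opposite-involutive i)) i≡0) (opposite-maximal i i≡0) (suc n) (s≤s z≤n)
  end-root i (inj₂ i≡w) = EndRooted.zeroForcing (fromStart _) i (opposite-of-last i i≡w)
    (λ x → subst (toℕ x ≤_) (sym i≡w) (≤-pred (toℕ<n x))) (suc n) (s≤s z≤n)
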